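{- In $\mathsf{GT}^-$, left contraction is height-preserving admissible, and right contraction is height-preserving admissible with respect to classical formulas: (left) $\vdash^n\Gamma,\nu,\nu\Rightarrow \Delta$ implies $\vdash^n\Gamma,\nu\Rightarrow \Delta$ for any formula $\nu$; (right) $\vdash^n\Gamma\Rightarrow \alpha,\alpha, \Delta$ implies $\vdash^n\Gamma\Rightarrow \alpha,\Delta$ for any classical formula $\alpha$.
   Context: Formulas: classical formulas $\alpha::=p\mid\bot\mid\neg\alpha\mid\alpha\wedge\alpha\mid\alpha\vee\alpha$; formulas of $\mathbf{PL}(\mathbin{\backslash\!\!\!/})$: $\phi::=\alpha\mid\phi\wedge\phi\mid\phi\vee\phi\mid\phi\mathbin{\backslash\!\!\!/}\phi$ ($\vee$ split disjunction, $\mathbin{\backslash\!\!\!/}$ inquisitive disjunction). $\Lambda$ ranges over finite multisets of classical formulas. $\mathsf{GT}^-$ is the cut-free calculus with axioms $\Gamma,p\Rightarrow p,\Delta$, $\Gamma,\bot\Rightarrow\Delta$ and rules: $\mathsf{L}\neg$ ($\Gamma\Rightarrow\alpha,\Delta$ / $\Gamma,\neg\alpha\Rightarrow\Delta$), $\mathsf{R}\neg$ ($\Gamma,\alpha\Rightarrow\Delta$ / $\Gamma\Rightarrow\neg\alpha,\Delta$), $\mathsf{L}\wedge$ ($\Gamma,\phi,\psi\Rightarrow\Delta$ / $\Gamma,\phi\wedge\psi\Rightarrow\Delta$), $\mathsf{R}\wedge$ ($\Gamma\Rightarrow\phi,\Lambda$ and $\Gamma\Rightarrow\psi,\Lambda$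 / $\Gamma\Rightarrow\phi\wedge\psi,\Lambda,\Delta$), $\mathsf{L}\vee$ ($\Gamma,\phi\Rightarrow\Lambda$ and $\Gamma,\psi\Rightarrow\Lambda$ / $\Gamma,\phi\vee\psi\Rightarrow\Lambda,\Delta$), $\mathsf{R}\vee$ ($\Gamma\Rightarrow\phi,\psi,\Delta$ / $\Gamma\Rightarrow\phi\vee\psi,\Delta$), $\mathsf{L}\mathbin{\backslash\!\!\!/}$ ($\Gamma,\chi\{\phi_L\}\Rightarrow\Delta$ and $\Gamma,\chi\{\phi_R\}\Rightarrow\Delta$ / $\Gamma,\chi\{\phi_L\mathbin{\backslash\!\!\!/}\phi_R\}\Rightarrow\Delta$), $\mathsf{R}\mathbin{\backslash\!\!\!/}$ ($\Gamma\Rightarrow\chi\{\phi_i\},\Delta$, $i\in\{L,R\}$ / $\Gamma\Rightarrow\chi\{\phi_L\mathbin{\backslash\!\!\!/}\phi_R\},\Delta$), where $\chi\{\eta\}$ replaces a fixed subformula occurrence of $\chi$ not in the scope of a negation by $\eta$. Height: a single axiom has height 1, otherwise 1 plus the maximum premise height. $\vdash^n\Gamma\Rightarrow\Delta$ means there is a $\mathsf{GT}^-$-derivation of $\Gamma\Rightarrow\Delta$ of height at most $n$. -}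

module Defs where

open import Data.Nat using (ℕ; suc)
open import Data.List using (List; []; _∷_; _++_; map)
open import Data.List.Relation.Binary.Permutation.Propositional using (_↭_)

data CFm : Set where
  catom : ℕ → CFm
  c⊥    : CFm
  c¬    : CFm → CFm
  _c∧_  : CFm → CFm → CFm
  _c∨_  : CFm → CFm → CFm

-- Negation is only applied to classical formulas; every formula has a
-- unique representation (classical formulas are the ⩔-free ones, see ⌜_⌝).
infixr 6 _∧_
infixr 5 _∨_ _⩔_
data Fm : Set where
  atom : ℕ → Fm
  ⊥f   : Fm
  ¬f   : CFm → Fm
  _∧_  : Fm → Fm → Fm
  _∨_  : Fm → Fm → Fm
  _⩔_  : Fm → Fm → Fm

⌜_⌝ : CFm → Fm
⌜ catom p ⌝ = atom p
⌜ c⊥ ⌝      = ⊥f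
⌜ c¬ α ⌝    = ¬f α
⌜ α c∧ β ⌝  = ⌜ α ⌝ ∧ ⌜ β ⌝
⌜ α c∨ β ⌝  = ⌜ α ⌝ ∨ ⌜ β ⌝

-- Contexts χ{ } : a fixed subformula occurrence not in the scope of a
-- negation (negation only takes classical arguments, so contexts never
-- enter a negation).
data Ctx : Set where
  hole : Ctx
  ∧l ∧r ∨l ∨r ⩔l ⩔r : Ctx → Fm → Ctx

plug : Ctx → Fm → Fm
plug hole    η = η
plug (∧l χ ψ) η = plug χ η ∧ ψ
plug (∧r χ ψ) η = ψ ∧ plug χ η
plug (∨l χ ψ) η = plug χ η ∨ ψ
plug (∨r χ ψ) η = ψ ∨ plug χ η
plug (⩔l χ ψ) η = plug χ η ⩔ ψ
plug (⩔r χ ψ) η = ψ ⩔ plug χ η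

-- Sequents Γ ⇒ Δ with Γ, Δ finite multisets, represented as lists up to
-- permutation (_↭_).  ⊢[ n ] Γ ⇒ Δ : a GT⁻-derivation of height at most n.
infix 3 ⊢[_]_⇒_
data ⊢[_]_⇒_ : ℕ → List Fm → List Fm → Set where
  ax  : ∀ {n Γ Δ Γ' Δ'} p → Γ' ↭ atom p ∷ Γ → Δ' ↭ atom p ∷ Δ → ⊢[ suc n ] Γ' ⇒ Δ'
  ax⊥ : ∀ {n Γ Γ' Δ} → Γ' ↭ ⊥f ∷ Γ → ⊢[ suc n ] Γ' ⇒ Δ
  L¬  : ∀ {n Γ Γ' Δ} α → Γ' ↭ ¬f α ∷ Γ →
        ⊢[ n ] Γ ⇒ ⌜ α ⌝ ∷ Δ → ⊢[ suc n ] Γ' ⇒ Δ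
  R¬  : ∀ {n Γ Δ Δ'} α → Δ' ↭ ¬f α ∷ Δ →
        ⊢[ n ] ⌜ α ⌝ ∷ Γ ⇒ Δ → ⊢[ suc n ] Γ ⇒ Δ'
  L∧  : ∀ {n Γ Γ' Δ} φ ψ → Γ' ↭ (φ ∧ ψ) ∷ Γ →
        ⊢[ n ] φ ∷ ψ ∷ Γ ⇒ Δ → ⊢[ suc n ] Γ' ⇒ Δ
  R∧  : ∀ {n Γ Δ Δ'} φ ψ (Λ : List CFm) → Δ' ↭ (φ ∧ ψ) ∷ (map ⌜_⌝ Λ ++ Δ) →
        ⊢[ n ] Γ ⇒ φ ∷ map ⌜_⌝ Λ → ⊢[ n ] Γ ⇒ ψ ∷ map ⌜_⌝ Λ →
        ⊢[ suc n ] Γ ⇒ Δ'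
  L∨  : ∀ {n Γ Γ' Δ Δ'} φ ψ (Λ : List CFm) → Γ' ↭ (φ ∨ ψ) ∷ Γ →
        Δ' ↭ map ⌜_⌝ Λ ++ Δ →
        ⊢[ n ] φ ∷ Γ ⇒ map ⌜_⌝ Λ → ⊢[ n ] ψ ∷ Γ ⇒ map ⌜_⌝ Λ →
        ⊢[ suc n ] Γ' ⇒ Δ'
  R∨  : ∀ {n Γ Δ Δ'} φ ψ → Δ' ↭ (φ ∨ ψ) ∷ Δ →
        ⊢[ n ] Γ ⇒ φ ∷ ψ ∷ Δ → ⊢[ suc n ] Γ ⇒ Δ'
  L⩔  : ∀ {n Γ Γ' Δ} χ φL φR → Γ' ↭ plug χ (φL ⩔ φR) ∷ Γ →
        ⊢[ n ] plug χ φL ∷ Γ ⇒ Δ → ⊢[ n ] plug χ φR ∷ Γ ⇒ Δ →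
        ⊢[ suc n ] Γ' ⇒ Δ
  R⩔L : ∀ {n Γ Δ Δ'} χ φL φR → Δ' ↭ plug χ (φL ⩔ φR) ∷ Δ →
        ⊢[ n ] Γ ⇒ plug χ φL ∷ Δ → ⊢[ suc n ] Γ ⇒ Δ'
  R⩔R : ∀ {n Γ Δ Δ'} χ φL φR → Δ' ↭ plug χ (φL ⩔ φR) ∷ Δ →
        ⊢[ n ] Γ ⇒ plug χ φR ∷ Δ → ⊢[ suc n ] Γ ⇒ Δ'

module Submission where

-- Both contractions are proved together, by induction on the size of the contracted
-- formula and, inside that, on the height of the derivation.  If no copy is principal
-- in the last rule, contract in the premises.  If one copy is principal, the other copy
-- is decomposed in the premises by a height-preserving inversion, and the resulting
-- strictly smaller formulas are contracted.  For L⩔ the inversion is stated for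
-- arbitrary partial resolutions φ ⇝ φ′ (any number of ⩔ resolved), a class closed under
-- commuting with the split χ{φL ⩔ φR} made by the last rule (split-⇝).  Right
-- contraction needs α classical: then α is never principal in the non-invertible R⩔
-- rules, and its decompositions stay classical, as the context Λ of R∧ and L∨ requires.

open import Defs
open import Data.Nat using (ℕ; zero; suc; _≤_; _<_; s≤s; _+_)
open import Data.Nat.Properties using (≤-refl; ≤-reflexive; ≤-pred; <-≤-trans; m≤m+n; m≤n+m; +-monoˡ-<; +-monoʳ-<)
open import Data.List using (List; []; _∷_; _++_; map)
open import Data.List.Properties using (map-++)
open import Data.List.Membership.Propositional using (_∈_)
open import Data.List.Membership.Propositional.Properties using (∈-∃++; ∈-++⁻; ∈-map⁻)
open import Data.List.Relation.Unary.Any using (here; there)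
open import Data.List.Relation.Binary.Permutation.Propositional
open import Data.List.Relation.Binary.Permutation.Propositional.Properties
open import Data.Product using (_×_; _,_; ∃)
open import Data.Sum using (_⊎_; inj₁; inj₂)
open import Data.Empty using (⊥-elim)
open import Relation.Nullary using (¬_)
open import Relation.Binary.PropositionalEquality using (_≡_; _≢_; refl; sym; cong; cong₂; subst)

private variable
  S T : Set
  x y : S
  xs ys zs : List S

infixr 5 _∙_
_∙_ : xs ↭ ys → ys ↭ zs → xs ↭ zs
_∙_ = ↭-trans

swap-heads : x ∷ y ∷ xs ↭ y ∷ x ∷ xs
swap-heads = swap _ _ refl

under : xs ↭ y ∷ ys → x ∷ xs ↭ y ∷ x ∷ ys
under p = prep _ p ∙ swap-heads

under₂ : ∀ {x′ : S} → xs ↭ y ∷ ys → x ∷ x′ ∷ xs ↭ y ∷ x ∷ x′ ∷ ys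
under₂ p = prep _ (under p) ∙ swap-heads

sink₂ : ∀ {z : S} → x ∷ y ∷ z ∷ xs ↭ y ∷ z ∷ x ∷ xs
sink₂ = ↭-sym (under₂ refl)

under-++ : ∀ zs → xs ↭ y ∷ ys → zs ++ xs ↭ y ∷ zs ++ ys
under-++ zs p = ++⁺ˡ zs p ∙ shift _ zs _

∈⇒↭∷ : x ∈ xs → ∃ λ ys → xs ↭ x ∷ ys
∈⇒↭∷ x∈xs with ∈-∃++ x∈xs
... | ys , zs , refl = ys ++ zs , shift _ ys zs

↭-∷-inv : x ∷ xs ↭ y ∷ ys → (x ≡ y × xs ↭ ys) ⊎ (∃ λ zs → ys ↭ x ∷ zs × xs ↭ y ∷ zs)
↭-∷-inv p with ∈-resp-↭ p (here refl)
... | here refl = inj₁ (refl , drop-∷ p)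
... | there x∈ys with ∈⇒↭∷ x∈ys
...   | zs , q = inj₂ (zs , q , drop-∷ (p ∙ under q))

↭-∷∷-inv : x ∷ x ∷ xs ↭ y ∷ ys →
           (x ≡ y × ys ↭ x ∷ xs) ⊎ (∃ λ zs → ys ↭ x ∷ x ∷ zs × xs ↭ y ∷ zs)
↭-∷∷-inv p with ↭-∷-inv p
... | inj₁ (x≡y , q) = inj₁ (x≡y , ↭-sym q)
... | inj₂ (zs , q , r) with ↭-∷-inv r
...   | inj₁ (x≡y , s)      = inj₁ (x≡y , q ∙ prep _ (↭-sym s))
...   | inj₂ (zs′ , s , t)  = inj₂ (zs′ , q ∙ prep _ s , t)

module _ (f : T → S) where

  ↭-map-++-inv : ∀ {us} → map f us ++ xs ↭ y ∷ ys →
    (∃ λ vs → map f us ↭ y ∷ map f vs × ys ↭ map f vs ++ xs) ⊎ (∃ λ zs → ys ↭ map f us ++ zs)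
  ↭-map-++-inv {xs = xs} {us = us} p with ∈-++⁻ (map f us) (∈-resp-↭ (↭-sym p) (here refl))
  ... | inj₁ y∈fus with ∈-map⁻ f y∈fus
  ...   | u , u∈us , refl with ∈⇒↭∷ u∈us
  ...     | vs , us↭ = inj₁ (vs , map⁺ f us↭ , drop-∷ (↭-sym p ∙ ++⁺ʳ xs (map⁺ f us↭)))
  ↭-map-++-inv {us = us} p | inj₂ y∈xs with ∈⇒↭∷ y∈xs
  ...   | zs , xs↭ = inj₂ (zs , drop-∷ (↭-sym p ∙ under-++ (map f us) xs↭))

  ↭-map-++-inv₂ : ∀ {us} → map f us ++ xs ↭ y ∷ y ∷ ys →
    (∃ λ vs → map f us ↭ y ∷ y ∷ map f vs × ys ↭ map f vs ++ xs) ⊎ (∃ λ zs → y ∷ ys ↭ map f us ++ zs)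
  ↭-map-++-inv₂ {xs = xs} p with ↭-map-++-inv p
  ... | inj₂ r = inj₂ r
  ... | inj₁ (vs , fus↭ , q) with ↭-map-++-inv (↭-sym q)
  ...   | inj₁ (ws , fvs↭ , r) = inj₁ (ws , fus↭ ∙ prep _ fvs↭ , r)
  ...   | inj₂ (zs , r)        = inj₂ (zs , prep _ r ∙ ↭-sym (++⁺ʳ zs fus↭))

⌜_⌝* : List CFm → List Fm
⌜ Λ ⌝* = map ⌜_⌝ Λ

private variable
  n : ℕ
  Γ Γ′ Δ Δ′ : List Fm
  φ ψ : Fm

⊢-resp-↭ : Γ ↭ Γ′ → Δ ↭ Δ′ → ⊢[ n ] Γ ⇒ Δ → ⊢[ n ] Γ′ ⇒ Δ′
⊢-resp-↭ g d (ax p x y)               = ax p (↭-sym g ∙ x) (↭-sym d ∙ y)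
⊢-resp-↭ g d (ax⊥ x)                  = ax⊥ (↭-sym g ∙ x)
⊢-resp-↭ g d (L¬ α x D)               = L¬ α (↭-sym g ∙ x) (⊢-resp-↭ refl (prep _ d) D)
⊢-resp-↭ g d (R¬ α x D)               = R¬ α (↭-sym d ∙ x) (⊢-resp-↭ (prep _ g) refl D)
⊢-resp-↭ g d (L∧ φ ψ x D)             = L∧ φ ψ (↭-sym g ∙ x) (⊢-resp-↭ refl d D)
⊢-resp-↭ g d (R∧ φ ψ Λ x D₁ D₂)       = R∧ φ ψ Λ (↭-sym d ∙ x) (⊢-resp-↭ g refl D₁) (⊢-resp-↭ g refl D₂)
⊢-resp-↭ g d (L∨ φ ψ Λ x y D₁ D₂)     = L∨ φ ψ Λ (↭-sym g ∙ x) (↭-sym d ∙ y) D₁ D₂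
⊢-resp-↭ g d (R∨ φ ψ x D)             = R∨ φ ψ (↭-sym d ∙ x) (⊢-resp-↭ g refl D)
⊢-resp-↭ g d (L⩔ χ φL φR x D₁ D₂)     = L⩔ χ φL φR (↭-sym g ∙ x) (⊢-resp-↭ refl d D₁) (⊢-resp-↭ refl d D₂)
⊢-resp-↭ g d (R⩔L χ φL φR x D)        = R⩔L χ φL φR (↭-sym d ∙ x) (⊢-resp-↭ g refl D)
⊢-resp-↭ g d (R⩔R χ φL φR x D)        = R⩔R χ φL φR (↭-sym d ∙ x) (⊢-resp-↭ g refl D)

⊢-resp-↭ˡ : Γ ↭ Γ′ → ⊢[ n ] Γ ⇒ Δ → ⊢[ n ] Γ′ ⇒ Δ
⊢-resp-↭ˡ g = ⊢-resp-↭ g refl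

⊢-resp-↭ʳ : Δ ↭ Δ′ → ⊢[ n ] Γ ⇒ Δ → ⊢[ n ] Γ ⇒ Δ′
⊢-resp-↭ʳ = ⊢-resp-↭ refl

⊢-suc : ⊢[ n ] Γ ⇒ Δ → ⊢[ suc n ] Γ ⇒ Δ
⊢-suc (ax p x y)            = ax p x y
⊢-suc (ax⊥ x)               = ax⊥ x
⊢-suc (L¬ α x D)            = L¬ α x (⊢-suc D)
⊢-suc (R¬ α x D)            = R¬ α x (⊢-suc D)
⊢-suc (L∧ φ ψ x D)          = L∧ φ ψ x (⊢-suc D)
⊢-suc (R∧ φ ψ Λ x D₁ D₂)    = R∧ φ ψ Λ x (⊢-suc D₁) (⊢-suc D₂)
⊢-suc (L∨ φ ψ Λ x y D₁ D₂)  = L∨ φ ψ Λ x y (⊢-suc D₁) (⊢-suc D₂)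
⊢-suc (R∨ φ ψ x D)          = R∨ φ ψ x (⊢-suc D)
⊢-suc (L⩔ χ φL φR x D₁ D₂)  = L⩔ χ φL φR x (⊢-suc D₁) (⊢-suc D₂)
⊢-suc (R⩔L χ φL φR x D)     = R⩔L χ φL φR x (⊢-suc D)
⊢-suc (R⩔R χ φL φR x D)     = R⩔R χ φL φR x (⊢-suc D)

weakenˡ : ∀ φ → ⊢[ n ] Γ ⇒ Δ → ⊢[ n ] φ ∷ Γ ⇒ Δ
weakenˡ φ (ax p x y)             = ax p (under x) y
weakenˡ φ (ax⊥ x)                = ax⊥ (under x)
weakenˡ φ (L¬ α x D)             = L¬ α (under x) (weakenˡ φ D)
weakenˡ φ (R¬ α x D)             = R¬ α x (⊢-resp-↭ˡ swap-heads (weakenˡ φ D))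
weakenˡ φ (L∧ ψ₁ ψ₂ x D)         = L∧ ψ₁ ψ₂ (under x) (⊢-resp-↭ˡ (↭-sym (under₂ refl)) (weakenˡ φ D))
weakenˡ φ (R∧ ψ₁ ψ₂ Λ x D₁ D₂)   = R∧ ψ₁ ψ₂ Λ x (weakenˡ φ D₁) (weakenˡ φ D₂)
weakenˡ φ (L∨ ψ₁ ψ₂ Λ x y D₁ D₂) = L∨ ψ₁ ψ₂ Λ (under x) y (⊢-resp-↭ˡ swap-heads (weakenˡ φ D₁))
                                                        (⊢-resp-↭ˡ swap-heads (weakenˡ φ D₂))
weakenˡ φ (R∨ ψ₁ ψ₂ x D)         = R∨ ψ₁ ψ₂ x (weakenˡ φ D)
weakenˡ φ (L⩔ χ φL φR x D₁ D₂)   = L⩔ χ φL φR (under x) (⊢-resp-↭ˡ swap-heads (weakenˡ φ D₁))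
                                                        (⊢-resp-↭ˡ swap-heads (weakenˡ φ D₂))
weakenˡ φ (R⩔L χ φL φR x D)      = R⩔L χ φL φR x (weakenˡ φ D)
weakenˡ φ (R⩔R χ φL φR x D)      = R⩔R χ φL φR x (weakenˡ φ D)

-- The new formula joins the unconstrained part of the succedent of R∧ and L∨.
weakenʳ : ∀ φ → ⊢[ n ] Γ ⇒ Δ → ⊢[ n ] Γ ⇒ φ ∷ Δ
weakenʳ φ (ax p x y)             = ax p x (under y)
weakenʳ φ (ax⊥ x)                = ax⊥ x
weakenʳ φ (L¬ α x D)             = L¬ α x (⊢-resp-↭ʳ swap-heads (weakenʳ φ D))
weakenʳ φ (R¬ α x D)             = R¬ α (under x) (weakenʳ φ D)
weakenʳ φ (L∧ ψ₁ ψ₂ x D)         = L∧ ψ₁ ψ₂ x (weakenʳ φ D)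
weakenʳ φ (R∧ ψ₁ ψ₂ Λ x D₁ D₂)   = R∧ ψ₁ ψ₂ Λ (under x ∙ prep _ (↭-sym (under-++ ⌜ Λ ⌝* refl))) D₁ D₂
weakenʳ φ (L∨ ψ₁ ψ₂ Λ x y D₁ D₂) = L∨ ψ₁ ψ₂ Λ x (prep φ y ∙ ↭-sym (under-++ ⌜ Λ ⌝* refl)) D₁ D₂
weakenʳ φ (R∨ ψ₁ ψ₂ x D)         = R∨ ψ₁ ψ₂ (under x) (⊢-resp-↭ʳ (↭-sym (under₂ refl)) (weakenʳ φ D))
weakenʳ φ (L⩔ χ φL φR x D₁ D₂)   = L⩔ χ φL φR x (weakenʳ φ D₁) (weakenʳ φ D₂)
weakenʳ φ (R⩔L χ φL φR x D)      = R⩔L χ φL φR (under x) (⊢-resp-↭ʳ swap-heads (weakenʳ φ D))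
weakenʳ φ (R⩔R χ φL φR x D)      = R⩔R χ φL φR (under x) (⊢-resp-↭ʳ swap-heads (weakenʳ φ D))

weakenˡ-++ : ∀ Θ → ⊢[ n ] Γ ⇒ Δ → ⊢[ n ] Θ ++ Γ ⇒ Δ
weakenˡ-++ []      D = D
weakenˡ-++ (φ ∷ Θ) D = weakenˡ φ (weakenˡ-++ Θ D)

weakenʳ-++ : ∀ Θ → ⊢[ n ] Γ ⇒ Δ → ⊢[ n ] Γ ⇒ Δ ++ Θ
weakenʳ-++ []      D = ⊢-resp-↭ʳ (↭-sym (++-identityʳ _)) D
weakenʳ-++ (φ ∷ Θ) D = ⊢-resp-↭ʳ (↭-sym (shift φ _ Θ)) (weakenʳ φ (weakenʳ-++ Θ D))

private variable
  φL φR φ′ ψL ψR ψ′ : Fm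

-- Split φ φL φR iff φ = χ{η₁ ⩔ η₂}, φL = χ{η₁} and φR = χ{η₂} for some χ, η₁, η₂;
-- unlike plug, it can be matched on.
data Split : Fm → Fm → Fm → Set where
  ⩔-split : Split (φ ⩔ ψ) φ ψ
  ∧ˡ : Split φ φL φR → Split (φ ∧ ψ) (φL ∧ ψ) (φR ∧ ψ)
  ∧ʳ : Split ψ ψL ψR → Split (φ ∧ ψ) (φ ∧ ψL) (φ ∧ ψR)
  ∨ˡ : Split φ φL φR → Split (φ ∨ ψ) (φL ∨ ψ) (φR ∨ ψ)
  ∨ʳ : Split ψ ψL ψR → Split (φ ∨ ψ) (φ ∨ ψL) (φ ∨ ψR)
  ⩔ˡ : Split φ φL φR → Split (φ ⩔ ψ) (φL ⩔ ψ) (φR ⩔ ψ)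
  ⩔ʳ : Split ψ ψL ψR → Split (φ ⩔ ψ) (φ ⩔ ψL) (φ ⩔ ψR)

plug-split : ∀ χ → Split (plug χ (φL ⩔ φR)) (plug χ φL) (plug χ φR)
plug-split hole       = ⩔-split
plug-split (∧l χ ψ)   = ∧ˡ (plug-split χ)
plug-split (∧r χ ψ)   = ∧ʳ (plug-split χ)
plug-split (∨l χ ψ)   = ∨ˡ (plug-split χ)
plug-split (∨r χ ψ)   = ∨ʳ (plug-split χ)
plug-split (⩔l χ ψ)   = ⩔ˡ (plug-split χ)
plug-split (⩔r χ ψ)   = ⩔ʳ (plug-split χ)

data Plugged : Fm → Fm → Fm → Set where
  plugged : ∀ χ η₁ η₂ → Plugged (plug χ (η₁ ⩔ η₂)) (plug χ η₁) (plug χ η₂)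

split⇒plugged : Split φ φL φR → Plugged φ φL φR
split⇒plugged ⩔-split = plugged hole _ _
split⇒plugged (∧ˡ s) with split⇒plugged s
... | plugged χ η₁ η₂ = plugged (∧l χ _) η₁ η₂
split⇒plugged (∧ʳ s) with split⇒plugged s
... | plugged χ η₁ η₂ = plugged (∧r χ _) η₁ η₂
split⇒plugged (∨ˡ s) with split⇒plugged s
... | plugged χ η₁ η₂ = plugged (∨l χ _) η₁ η₂
split⇒plugged (∨ʳ s) with split⇒plugged s
... | plugged χ η₁ η₂ = plugged (∨r χ _) η₁ η₂
split⇒plugged (⩔ˡ s) with split⇒plugged s
... | plugged χ η₁ η₂ = plugged (⩔l χ _) η₁ η₂
split⇒plugged (⩔ʳ s) with split⇒plugged s
... | plugged χ η₁ η₂ = plugged (⩔r χ _) η₁ η₂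

L⩔-split : Split φ φL φR → Γ′ ↭ φ ∷ Γ →
           ⊢[ n ] φL ∷ Γ ⇒ Δ → ⊢[ n ] φR ∷ Γ ⇒ Δ → ⊢[ suc n ] Γ′ ⇒ Δ
L⩔-split s with split⇒plugged s
... | plugged χ η₁ η₂ = L⩔ χ η₁ η₂

infix 4 _⇝_
data _⇝_ : Fm → Fm → Set where
  ⇝-refl    : φ ⇝ φ
  ∧⁺        : φ ⇝ φ′ → ψ ⇝ ψ′ → φ ∧ ψ ⇝ φ′ ∧ ψ′
  ∨⁺        : φ ⇝ φ′ → ψ ⇝ ψ′ → φ ∨ ψ ⇝ φ′ ∨ ψ′
  ⩔⁺        : φ ⇝ φ′ → ψ ⇝ ψ′ → φ ⩔ ψ ⇝ φ′ ⩔ ψ′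
  ⩔-chooseˡ : φ ⇝ φ′ → φ ⩔ ψ ⇝ φ′
  ⩔-chooseʳ : ψ ⇝ ψ′ → φ ⩔ ψ ⇝ ψ′

split⇝ˡ : Split φ φL φR → φ ⇝ φL
split⇝ˡ ⩔-split = ⩔-chooseˡ ⇝-refl
split⇝ˡ (∧ˡ s)  = ∧⁺ (split⇝ˡ s) ⇝-refl
split⇝ˡ (∧ʳ s)  = ∧⁺ ⇝-refl (split⇝ˡ s)
split⇝ˡ (∨ˡ s)  = ∨⁺ (split⇝ˡ s) ⇝-refl
split⇝ˡ (∨ʳ s)  = ∨⁺ ⇝-refl (split⇝ˡ s)
split⇝ˡ (⩔ˡ s)  = ⩔⁺ (split⇝ˡ s) ⇝-refl
split⇝ˡ (⩔ʳ s)  = ⩔⁺ ⇝-refl (split⇝ˡ s)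

split⇝ʳ : Split φ φL φR → φ ⇝ φR
split⇝ʳ ⩔-split = ⩔-chooseʳ ⇝-refl
split⇝ʳ (∧ˡ s)  = ∧⁺ (split⇝ʳ s) ⇝-refl
split⇝ʳ (∧ʳ s)  = ∧⁺ ⇝-refl (split⇝ʳ s)
split⇝ʳ (∨ˡ s)  = ∨⁺ (split⇝ʳ s) ⇝-refl
split⇝ʳ (∨ʳ s)  = ∨⁺ ⇝-refl (split⇝ʳ s)
split⇝ʳ (⩔ˡ s)  = ⩔⁺ (split⇝ʳ s) ⇝-refl
split⇝ʳ (⩔ʳ s)  = ⩔⁺ ⇝-refl (split⇝ʳ s)

-- The ways φ′ ∷ Γ ⇒ Δ follows from φL ∷ Γ ⇒ Δ and φR ∷ Γ ⇒ Δ by inversion and L⩔.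
data _∣_⇝_ (φL φR : Fm) : Fm → Set where
  via-left  : φL ⇝ φ′ → φL ∣ φR ⇝ φ′
  via-right : φR ⇝ φ′ → φL ∣ φR ⇝ φ′
  re-split  : Split φ′ ψL ψR → φL ⇝ ψL → φR ⇝ ψR → φL ∣ φR ⇝ φ′

∣⇝-map : {F G : Fm → Fm} → (∀ {η η′} → η ⇝ η′ → F η ⇝ G η′) →
         (∀ {η ηL ηR} → Split η ηL ηR → Split (G η) (G ηL) (G ηR)) →
         φL ∣ φR ⇝ φ′ → F φL ∣ F φR ⇝ G φ′
∣⇝-map f g (via-left r)       = via-left (f r)
∣⇝-map f g (via-right r)      = via-right (f r)
∣⇝-map f g (re-split s r₁ r₂) = re-split (g s) (f r₁) (f r₂)

split-⇝ : Split φ φL φR → φ ⇝ φ′ → φL ∣ φR ⇝ φ′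
split-⇝ s       ⇝-refl          = re-split s ⇝-refl ⇝-refl
split-⇝ ⩔-split (⩔⁺ r₁ r₂)      = re-split ⩔-split r₁ r₂
split-⇝ ⩔-split (⩔-chooseˡ r)   = via-left r
split-⇝ ⩔-split (⩔-chooseʳ r)   = via-right r
split-⇝ (∧ˡ s)  (∧⁺ r₁ r₂)      = ∣⇝-map (λ r → ∧⁺ r r₂) ∧ˡ (split-⇝ s r₁)
split-⇝ (∧ʳ s)  (∧⁺ r₁ r₂)      = ∣⇝-map (∧⁺ r₁) ∧ʳ (split-⇝ s r₂)
split-⇝ (∨ˡ s)  (∨⁺ r₁ r₂)      = ∣⇝-map (λ r → ∨⁺ r r₂) ∨ˡ (split-⇝ s r₁)
split-⇝ (∨ʳ s)  (∨⁺ r₁ r₂)      = ∣⇝-map (∨⁺ r₁) ∨ʳ (split-⇝ s r₂)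
split-⇝ (⩔ˡ s)  (⩔⁺ r₁ r₂)      = ∣⇝-map (λ r → ⩔⁺ r r₂) ⩔ˡ (split-⇝ s r₁)
split-⇝ (⩔ˡ s)  (⩔-chooseˡ r)   = ∣⇝-map ⩔-chooseˡ (λ t → t) (split-⇝ s r)
split-⇝ (⩔ˡ s)  (⩔-chooseʳ r)   = via-left (⩔-chooseʳ r)
split-⇝ (⩔ʳ s)  (⩔⁺ r₁ r₂)      = ∣⇝-map (⩔⁺ r₁) ⩔ʳ (split-⇝ s r₂)
split-⇝ (⩔ʳ s)  (⩔-chooseˡ r)   = via-left (⩔-chooseˡ r)
split-⇝ (⩔ʳ s)  (⩔-chooseʳ r)   = ∣⇝-map ⩔-chooseʳ (λ t → t) (split-⇝ s r)

csize : CFm → ℕ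
csize (catom _) = 1
csize c⊥        = 1
csize (c¬ α)    = suc (csize α)
csize (α c∧ β)  = suc (csize α + csize β)
csize (α c∨ β)  = suc (csize α + csize β)

size : Fm → ℕ
size (atom _) = 1
size ⊥f       = 1
size (¬f α)   = suc (csize α)
size (φ ∧ ψ)  = suc (size φ + size ψ)
size (φ ∨ ψ)  = suc (size φ + size ψ)
size (φ ⩔ ψ)  = suc (size φ + size ψ)

size-⌜⌝ : ∀ α → size ⌜ α ⌝ ≡ csize α
size-⌜⌝ (catom _) = refl
size-⌜⌝ c⊥        = refl
size-⌜⌝ (c¬ α)    = refl
size-⌜⌝ (α c∧ β)  = cong₂ (λ m k → suc (m + k)) (size-⌜⌝ α) (size-⌜⌝ β)
size-⌜⌝ (α c∨ β)  = cong₂ (λ m k → suc (m + k)) (size-⌜⌝ α) (size-⌜⌝ β)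

split-size<ˡ : Split φ φL φR → size φL < size φ
split-size<ˡ {φ ⩔ ψ} ⩔-split = s≤s (m≤m+n (size φ) (size ψ))
split-size<ˡ (∧ˡ {ψ = ψ} s) = s≤s (+-monoˡ-< (size ψ) (split-size<ˡ s))
split-size<ˡ (∧ʳ {φ = φ} s) = s≤s (+-monoʳ-< (size φ) (split-size<ˡ s))
split-size<ˡ (∨ˡ {ψ = ψ} s) = s≤s (+-monoˡ-< (size ψ) (split-size<ˡ s))
split-size<ˡ (∨ʳ {φ = φ} s) = s≤s (+-monoʳ-< (size φ) (split-size<ˡ s))
split-size<ˡ (⩔ˡ {ψ = ψ} s) = s≤s (+-monoˡ-< (size ψ) (split-size<ˡ s))
split-size<ˡ (⩔ʳ {φ = φ} s) = s≤s (+-monoʳ-< (size φ) (split-size<ˡ s))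

split-size<ʳ : Split φ φL φR → size φR < size φ
split-size<ʳ {φ ⩔ ψ} ⩔-split = s≤s (m≤n+m (size ψ) (size φ))
split-size<ʳ (∧ˡ {ψ = ψ} s) = s≤s (+-monoˡ-< (size ψ) (split-size<ʳ s))
split-size<ʳ (∧ʳ {φ = φ} s) = s≤s (+-monoʳ-< (size φ) (split-size<ʳ s))
split-size<ʳ (∨ˡ {ψ = ψ} s) = s≤s (+-monoˡ-< (size ψ) (split-size<ʳ s))
split-size<ʳ (∨ʳ {φ = φ} s) = s≤s (+-monoʳ-< (size φ) (split-size<ʳ s))
split-size<ʳ (⩔ˡ {ψ = ψ} s) = s≤s (+-monoˡ-< (size ψ) (split-size<ʳ s))
split-size<ʳ (⩔ʳ {φ = φ} s) = s≤s (+-monoʳ-< (size φ) (split-size<ʳ s))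

private variable
  A : Fm
  L Γ₀ Δ₀ Z : List Fm
  R Λ : List CFm
  α : CFm

⌜⌝*-++ : ∀ R Λ → ⌜ R ⌝* ++ ⌜ Λ ⌝* ↭ ⌜ R ++ Λ ⌝*
⌜⌝*-++ R Λ = ↭-reflexive (sym (map-++ ⌜_⌝ R Λ))

⌜⌝*-++-assoc : ∀ R Λ → ⌜ R ⌝* ++ ⌜ Λ ⌝* ++ Δ ↭ ⌜ R ++ Λ ⌝* ++ Δ
⌜⌝*-++-assoc {Δ} R Λ = ↭-sym (++-assoc ⌜ R ⌝* ⌜ Λ ⌝* Δ) ∙ ++⁺ʳ Δ (⌜⌝*-++ R Λ)

shift₂ : ∀ (L : List Fm) → L ++ φ ∷ ψ ∷ Γ ↭ φ ∷ ψ ∷ L ++ Γ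
shift₂ L = shift _ L _ ∙ prep _ (shift _ L _)

data LeftInversion : Fm → List Fm → List CFm → Set where
  inv-∧  : ∀ φ ψ → LeftInversion (φ ∧ ψ) (φ ∷ ψ ∷ []) []
  inv-∨ˡ : ∀ φ ψ → LeftInversion (φ ∨ ψ) (φ ∷ []) []
  inv-∨ʳ : ∀ φ ψ → LeftInversion (φ ∨ ψ) (ψ ∷ []) []
  inv-¬  : ∀ α → LeftInversion (¬f α) [] (α ∷ [])
  inv-⇝  : φ ⇝ φ′ → LeftInversion φ (φ′ ∷ []) []

LeftInvertible : ℕ → Set
LeftInvertible n = ∀ {A L R Γ Δ} → LeftInversion A L R →
                   ⊢[ n ] A ∷ Γ ⇒ Δ → ⊢[ n ] L ++ Γ ⇒ ⌜ R ⌝* ++ Δ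

invertˡ-ax : ∀ {p} → LeftInversion (atom p) L R → Δ ↭ atom p ∷ Δ₀ →
             ⊢[ suc n ] L ++ Γ ⇒ ⌜ R ⌝* ++ Δ
invertˡ-ax (inv-⇝ ⇝-refl) y = ax _ refl y

invertˡ-ax⊥ : LeftInversion ⊥f L R → ⊢[ suc n ] L ++ Γ ⇒ ⌜ R ⌝* ++ Δ
invertˡ-ax⊥ (inv-⇝ ⇝-refl) = ax⊥ refl

invertˡ-L¬ : LeftInversion (¬f α) L R → Γ ↭ Γ₀ → ⊢[ n ] Γ₀ ⇒ ⌜ α ⌝ ∷ Δ →
             ⊢[ suc n ] L ++ Γ ⇒ ⌜ R ⌝* ++ Δ
invertˡ-L¬ (inv-¬ α)      g D = ⊢-suc (⊢-resp-↭ˡ (↭-sym g) D)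
invertˡ-L¬ (inv-⇝ ⇝-refl) g D = L¬ _ (prep _ g) D

invertˡ-L∧ : LeftInvertible n → LeftInversion (φ ∧ ψ) L R → Γ ↭ Γ₀ →
             ⊢[ n ] φ ∷ ψ ∷ Γ₀ ⇒ Δ → ⊢[ suc n ] L ++ Γ ⇒ ⌜ R ⌝* ++ Δ
invertˡ-L∧ ih (inv-∧ φ ψ)            g D = ⊢-suc (⊢-resp-↭ˡ (prep φ (prep ψ (↭-sym g))) D)
invertˡ-L∧ ih (inv-⇝ ⇝-refl)         g D = L∧ _ _ (prep _ g) D
invertˡ-L∧ ih (inv-⇝ (∧⁺ r₁ r₂))     g D =
  L∧ _ _ (prep _ g) (⊢-resp-↭ˡ swap-heads (ih (inv-⇝ r₂) (⊢-resp-↭ˡ swap-heads (ih (inv-⇝ r₁) D))))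

invertˡ-L∨ : LeftInvertible n → LeftInversion (φ ∨ ψ) L R → Γ ↭ Γ₀ → Δ ↭ ⌜ Λ ⌝* ++ Δ₀ →
             ⊢[ n ] φ ∷ Γ₀ ⇒ ⌜ Λ ⌝* → ⊢[ n ] ψ ∷ Γ₀ ⇒ ⌜ Λ ⌝* → ⊢[ suc n ] L ++ Γ ⇒ ⌜ R ⌝* ++ Δ
invertˡ-L∨ {Δ₀ = Δ₀} ih (inv-∨ˡ φ ψ) g d D₁ D₂ =
  ⊢-suc (⊢-resp-↭ (prep φ (↭-sym g)) (↭-sym d) (weakenʳ-++ Δ₀ D₁))
invertˡ-L∨ {Δ₀ = Δ₀} ih (inv-∨ʳ φ ψ) g d D₁ D₂ =
  ⊢-suc (⊢-resp-↭ (prep ψ (↭-sym g)) (↭-sym d) (weakenʳ-++ Δ₀ D₂))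
invertˡ-L∨ ih (inv-⇝ ⇝-refl)     g d D₁ D₂ = L∨ _ _ _ (prep _ g) d D₁ D₂
invertˡ-L∨ ih (inv-⇝ (∨⁺ r₁ r₂)) g d D₁ D₂ =
  L∨ _ _ _ (prep _ g) d (ih (inv-⇝ r₁) D₁) (ih (inv-⇝ r₂) D₂)

invertˡ-L⩔ : LeftInvertible n → LeftInversion A L R → Split A φL φR → Γ ↭ Γ₀ →
             ⊢[ n ] φL ∷ Γ₀ ⇒ Δ → ⊢[ n ] φR ∷ Γ₀ ⇒ Δ → ⊢[ suc n ] L ++ Γ ⇒ ⌜ R ⌝* ++ Δ
invertˡ-L⩔ ih (inv-⇝ r) s g D₁ D₂ with split-⇝ s r
... | via-left q         = ⊢-suc (⊢-resp-↭ˡ (prep _ (↭-sym g)) (ih (inv-⇝ q) D₁))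
... | via-right q        = ⊢-suc (⊢-resp-↭ˡ (prep _ (↭-sym g)) (ih (inv-⇝ q) D₂))
... | re-split t q₁ q₂   = L⩔-split t (prep _ g) (ih (inv-⇝ q₁) D₁) (ih (inv-⇝ q₂) D₂)
invertˡ-L⩔ ih (inv-∧ _ _) (∧ˡ s) g D₁ D₂ =
  L⩔-split s (prep _ (prep _ g)) (ih (inv-∧ _ _) D₁) (ih (inv-∧ _ _) D₂)
invertˡ-L⩔ ih (inv-∧ _ _) (∧ʳ s) g D₁ D₂ =
  L⩔-split s (swap-heads ∙ prep _ (prep _ g))
    (⊢-resp-↭ˡ swap-heads (ih (inv-∧ _ _) D₁)) (⊢-resp-↭ˡ swap-heads (ih (inv-∧ _ _) D₂))
invertˡ-L⩔ ih (inv-∨ˡ _ _) (∨ˡ s) g D₁ D₂ =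
  L⩔-split s (prep _ g) (ih (inv-∨ˡ _ _) D₁) (ih (inv-∨ˡ _ _) D₂)
invertˡ-L⩔ ih (inv-∨ˡ _ _) (∨ʳ s) g D₁ D₂ = ⊢-suc (⊢-resp-↭ˡ (prep _ (↭-sym g)) (ih (inv-∨ˡ _ _) D₁))
invertˡ-L⩔ ih (inv-∨ʳ _ _) (∨ˡ s) g D₁ D₂ = ⊢-suc (⊢-resp-↭ˡ (prep _ (↭-sym g)) (ih (inv-∨ʳ _ _) D₁))
invertˡ-L⩔ ih (inv-∨ʳ _ _) (∨ʳ s) g D₁ D₂ =
  L⩔-split s (prep _ g) (ih (inv-∨ʳ _ _) D₁) (ih (inv-∨ʳ _ _) D₂)
invertˡ-L⩔ ih (inv-¬ _) () g D₁ D₂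

invertˡ : ∀ n → LeftInvertible n
invertˡ zero I ()
invertˡ (suc n) {L = L} {R} I (ax p x y) with ↭-∷-inv x
... | inj₁ (refl , _)  = invertˡ-ax I y
... | inj₂ (_ , _ , g) = ax p (under-++ L g) (under-++ ⌜ R ⌝* y)
invertˡ (suc n) {L = L} I (ax⊥ x) with ↭-∷-inv x
... | inj₁ (refl , _)  = invertˡ-ax⊥ I
... | inj₂ (_ , _ , g) = ax⊥ (under-++ L g)
invertˡ (suc n) {L = L} {R} I (L¬ α x D) with ↭-∷-inv x
... | inj₁ (refl , g)  = invertˡ-L¬ I g D
... | inj₂ (_ , q , g) =
  L¬ α (under-++ L g) (⊢-resp-↭ʳ (shift _ ⌜ R ⌝* _) (invertˡ n I (⊢-resp-↭ˡ q D)))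
invertˡ (suc n) {L = L} {R} I (R¬ α x D) =
  R¬ α (under-++ ⌜ R ⌝* x) (⊢-resp-↭ˡ (shift _ L _) (invertˡ n I (⊢-resp-↭ˡ swap-heads D)))
invertˡ (suc n) {L = L} I (L∧ φ ψ x D) with ↭-∷-inv x
... | inj₁ (refl , g)  = invertˡ-L∧ (invertˡ n) I g D
... | inj₂ (_ , q , g) =
  L∧ φ ψ (under-++ L g) (⊢-resp-↭ˡ (shift₂ L) (invertˡ n I (⊢-resp-↭ˡ (under₂ q) D)))
invertˡ (suc n) {R = R} I (R∧ φ ψ Λ x D₁ D₂) =
  R∧ φ ψ (R ++ Λ) (++⁺ˡ ⌜ R ⌝* x ∙ shift _ ⌜ R ⌝* _ ∙ prep _ (⌜⌝*-++-assoc R Λ))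
    (⊢-resp-↭ʳ (shift _ ⌜ R ⌝* _ ∙ prep φ (⌜⌝*-++ R Λ)) (invertˡ n I D₁))
    (⊢-resp-↭ʳ (shift _ ⌜ R ⌝* _ ∙ prep ψ (⌜⌝*-++ R Λ)) (invertˡ n I D₂))
invertˡ (suc n) {L = L} {R} I (L∨ φ ψ Λ x y D₁ D₂) with ↭-∷-inv x
... | inj₁ (refl , g)  = invertˡ-L∨ (invertˡ n) I g y D₁ D₂
... | inj₂ (_ , q , g) =
  L∨ φ ψ (R ++ Λ) (under-++ L g) (++⁺ˡ ⌜ R ⌝* y ∙ ⌜⌝*-++-assoc R Λ)
    (⊢-resp-↭ (shift _ L _) (⌜⌝*-++ R Λ) (invertˡ n I (⊢-resp-↭ˡ (under q) D₁)))
    (⊢-resp-↭ (shift _ L _) (⌜⌝*-++ R Λ) (invertˡ n I (⊢-resp-↭ˡ (under q) D₂)))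
invertˡ (suc n) {R = R} I (R∨ φ ψ x D) =
  R∨ φ ψ (under-++ ⌜ R ⌝* x) (⊢-resp-↭ʳ (shift₂ ⌜ R ⌝*) (invertˡ n I D))
invertˡ (suc n) {L = L} I (L⩔ χ η₁ η₂ x D₁ D₂) with ↭-∷-inv x
... | inj₁ (refl , g)  = invertˡ-L⩔ (invertˡ n) I (plug-split χ) g D₁ D₂
... | inj₂ (_ , q , g) =
  L⩔ χ η₁ η₂ (under-++ L g)
    (⊢-resp-↭ˡ (shift _ L _) (invertˡ n I (⊢-resp-↭ˡ (under q) D₁)))
    (⊢-resp-↭ˡ (shift _ L _) (invertˡ n I (⊢-resp-↭ˡ (under q) D₂)))
invertˡ (suc n) {R = R} I (R⩔L χ η₁ η₂ x D) =
  R⩔L χ η₁ η₂ (under-++ ⌜ R ⌝* x) (⊢-resp-↭ʳ (shift _ ⌜ R ⌝* _) (invertˡ n I D))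
invertˡ (suc n) {R = R} I (R⩔R χ η₁ η₂ x D) =
  R⩔R χ η₁ η₂ (under-++ ⌜ R ⌝* x) (⊢-resp-↭ʳ (shift _ ⌜ R ⌝* _) (invertˡ n I D))

⌜⌝-unsplittable : ∀ α → ¬ Split ⌜ α ⌝ φL φR
⌜⌝-unsplittable (catom _) ()
⌜⌝-unsplittable c⊥        ()
⌜⌝-unsplittable (c¬ _)    ()
⌜⌝-unsplittable (α c∧ β) (∧ˡ s) = ⌜⌝-unsplittable α s
⌜⌝-unsplittable (α c∧ β) (∧ʳ s) = ⌜⌝-unsplittable β s
⌜⌝-unsplittable (α c∨ β) (∨ˡ s) = ⌜⌝-unsplittable α s
⌜⌝-unsplittable (α c∨ β) (∨ʳ s) = ⌜⌝-unsplittable β s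

data RightInversion : Fm → List Fm → List CFm → Set where
  inv-¬  : ∀ α → RightInversion (¬f α) (⌜ α ⌝ ∷ []) []
  inv-∧ˡ : ∀ α β → RightInversion (⌜ α ⌝ ∧ ⌜ β ⌝) [] (α ∷ [])
  inv-∧ʳ : ∀ α β → RightInversion (⌜ α ⌝ ∧ ⌜ β ⌝) [] (β ∷ [])
  inv-∨  : ∀ α β → RightInversion (⌜ α ⌝ ∨ ⌜ β ⌝) [] (α ∷ β ∷ [])

RightInvertible : ℕ → Set
RightInvertible n = ∀ {A L R Γ Δ} → RightInversion A L R →
                    ⊢[ n ] Γ ⇒ A ∷ Δ → ⊢[ n ] L ++ Γ ⇒ ⌜ R ⌝* ++ Δ

rightInversion-unsplittable : RightInversion A L R → ¬ Split A φL φR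
rightInversion-unsplittable (inv-¬ α)    ()
rightInversion-unsplittable (inv-∧ˡ α β) = ⌜⌝-unsplittable (α c∧ β)
rightInversion-unsplittable (inv-∧ʳ α β) = ⌜⌝-unsplittable (α c∧ β)
rightInversion-unsplittable (inv-∨ α β)  = ⌜⌝-unsplittable (α c∨ β)

invertʳ-R¬ : RightInversion (¬f α) L R → Δ ↭ Δ₀ → ⊢[ n ] ⌜ α ⌝ ∷ Γ ⇒ Δ₀ →
             ⊢[ suc n ] L ++ Γ ⇒ ⌜ R ⌝* ++ Δ
invertʳ-R¬ (inv-¬ α) d D = ⊢-suc (⊢-resp-↭ʳ (↭-sym d) D)

invertʳ-R∧ : RightInversion (φ ∧ ψ) L R → Δ ↭ ⌜ Λ ⌝* ++ Δ₀ →
             ⊢[ n ] Γ ⇒ φ ∷ ⌜ Λ ⌝* → ⊢[ n ] Γ ⇒ ψ ∷ ⌜ Λ ⌝* → ⊢[ suc n ] L ++ Γ ⇒ ⌜ R ⌝* ++ Δ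
invertʳ-R∧ {Δ₀ = Δ₀} (inv-∧ˡ α β) d D₁ D₂ = ⊢-suc (⊢-resp-↭ʳ (prep _ (↭-sym d)) (weakenʳ-++ Δ₀ D₁))
invertʳ-R∧ {Δ₀ = Δ₀} (inv-∧ʳ α β) d D₁ D₂ = ⊢-suc (⊢-resp-↭ʳ (prep _ (↭-sym d)) (weakenʳ-++ Δ₀ D₂))

invertʳ-R∨ : RightInversion (φ ∨ ψ) L R → Δ ↭ Δ₀ → ⊢[ n ] Γ ⇒ φ ∷ ψ ∷ Δ₀ →
             ⊢[ suc n ] L ++ Γ ⇒ ⌜ R ⌝* ++ Δ
invertʳ-R∨ (inv-∨ α β) d D = ⊢-suc (⊢-resp-↭ʳ (prep _ (prep _ (↭-sym d))) D)

-- A lies either in Λ, where R replaces it, or in the unconstrained part of the succedent.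
invertʳ-R∧-nonprincipal : RightInvertible n → RightInversion A L R →
                  ⌜ Λ ⌝* ++ Δ₀ ↭ A ∷ Z → Δ ↭ (φ ∧ ψ) ∷ Z →
                  ⊢[ n ] Γ ⇒ φ ∷ ⌜ Λ ⌝* → ⊢[ n ] Γ ⇒ ψ ∷ ⌜ Λ ⌝* → ⊢[ suc n ] L ++ Γ ⇒ ⌜ R ⌝* ++ Δ
invertʳ-R∧-nonprincipal {R = R} {Λ = Λ} ih I q d D₁ D₂ with ↭-map-++-inv ⌜_⌝ q
... | inj₁ (Λ₁ , h , k) =
  R∧ _ _ (R ++ Λ₁) (++⁺ˡ ⌜ R ⌝* (d ∙ prep _ k) ∙ shift _ ⌜ R ⌝* _ ∙ prep _ (⌜⌝*-++-assoc R Λ₁))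
    (⊢-resp-↭ʳ (shift _ ⌜ R ⌝* _ ∙ prep _ (⌜⌝*-++ R Λ₁)) (ih I (⊢-resp-↭ʳ (prep _ h ∙ swap-heads) D₁)))
    (⊢-resp-↭ʳ (shift _ ⌜ R ⌝* _ ∙ prep _ (⌜⌝*-++ R Λ₁)) (ih I (⊢-resp-↭ʳ (prep _ h ∙ swap-heads) D₂)))
... | inj₂ (_ , k) =
  R∧ _ _ Λ (++⁺ˡ ⌜ R ⌝* (d ∙ prep _ k) ∙ shift _ ⌜ R ⌝* _ ∙ prep _ (shifts ⌜ R ⌝* ⌜ Λ ⌝*))
    (weakenˡ-++ _ D₁) (weakenˡ-++ _ D₂)

invertʳ-L∨ : RightInvertible n → RightInversion A L R → Γ ↭ (φ ∨ ψ) ∷ Γ₀ →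
                  A ∷ Δ ↭ ⌜ Λ ⌝* ++ Δ₀ →
                  ⊢[ n ] φ ∷ Γ₀ ⇒ ⌜ Λ ⌝* → ⊢[ n ] ψ ∷ Γ₀ ⇒ ⌜ Λ ⌝* → ⊢[ suc n ] L ++ Γ ⇒ ⌜ R ⌝* ++ Δ
invertʳ-L∨ {L = L} {R = R} {Λ = Λ} ih I x y D₁ D₂ with ↭-map-++-inv ⌜_⌝ (↭-sym y)
... | inj₁ (Λ₁ , h , k) =
  L∨ _ _ (R ++ Λ₁) (under-++ L x) (++⁺ˡ ⌜ R ⌝* k ∙ ⌜⌝*-++-assoc R Λ₁)
    (⊢-resp-↭ (shift _ L _) (⌜⌝*-++ R Λ₁) (ih I (⊢-resp-↭ʳ h D₁)))
    (⊢-resp-↭ (shift _ L _) (⌜⌝*-++ R Λ₁) (ih I (⊢-resp-↭ʳ h D₂)))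
... | inj₂ (_ , k) =
  L∨ _ _ Λ (under-++ L x) (++⁺ˡ ⌜ R ⌝* k ∙ shifts ⌜ R ⌝* ⌜ Λ ⌝*)
    (⊢-resp-↭ˡ (shift _ L _) (weakenˡ-++ L D₁)) (⊢-resp-↭ˡ (shift _ L _) (weakenˡ-++ L D₂))

invertʳ : ∀ n → RightInvertible n
invertʳ zero I ()
invertʳ (suc n) {L = L} {R} I (ax p x y) with ↭-∷-inv y
invertʳ (suc n) () (ax p x y) | inj₁ (refl , _)
... | inj₂ (_ , _ , d) = ax p (under-++ L x) (under-++ ⌜ R ⌝* d)
invertʳ (suc n) {L = L} I (ax⊥ x) = ax⊥ (under-++ L x)
invertʳ (suc n) {L = L} {R} I (L¬ α x D) =
  L¬ α (under-++ L x) (⊢-resp-↭ʳ (shift _ ⌜ R ⌝* _) (invertʳ n I (⊢-resp-↭ʳ swap-heads D)))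
invertʳ (suc n) {L = L} {R} I (R¬ α x D) with ↭-∷-inv x
... | inj₁ (refl , d)  = invertʳ-R¬ I d D
... | inj₂ (_ , q , d) =
  R¬ α (under-++ ⌜ R ⌝* d) (⊢-resp-↭ˡ (shift _ L _) (invertʳ n I (⊢-resp-↭ʳ q D)))
invertʳ (suc n) {L = L} I (L∧ φ ψ x D) =
  L∧ φ ψ (under-++ L x) (⊢-resp-↭ˡ (shift₂ L) (invertʳ n I D))
invertʳ (suc n) I (R∧ φ ψ Λ x D₁ D₂) with ↭-∷-inv x
... | inj₁ (refl , d)  = invertʳ-R∧ I d D₁ D₂
... | inj₂ (_ , q , d) = invertʳ-R∧-nonprincipal (invertʳ n) I q d D₁ D₂
invertʳ (suc n) I (L∨ φ ψ Λ x y D₁ D₂) = invertʳ-L∨ (invertʳ n) I x y D₁ D₂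
invertʳ (suc n) {R = R} I (R∨ φ ψ x D) with ↭-∷-inv x
... | inj₁ (refl , d)  = invertʳ-R∨ I d D
... | inj₂ (_ , q , d) =
  R∨ φ ψ (under-++ ⌜ R ⌝* d) (⊢-resp-↭ʳ (shift₂ ⌜ R ⌝*) (invertʳ n I (⊢-resp-↭ʳ (under₂ q) D)))
invertʳ (suc n) {L = L} I (L⩔ χ η₁ η₂ x D₁ D₂) =
  L⩔ χ η₁ η₂ (under-++ L x) (⊢-resp-↭ˡ (shift _ L _) (invertʳ n I D₁))
                            (⊢-resp-↭ˡ (shift _ L _) (invertʳ n I D₂))
invertʳ (suc n) {R = R} I (R⩔L χ η₁ η₂ x D) with ↭-∷-inv x
... | inj₁ (refl , _)  = ⊥-elim (rightInversion-unsplittable I (plug-split χ))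
... | inj₂ (_ , q , d) =
  R⩔L χ η₁ η₂ (under-++ ⌜ R ⌝* d) (⊢-resp-↭ʳ (shift _ ⌜ R ⌝* _) (invertʳ n I (⊢-resp-↭ʳ (under q) D)))
invertʳ (suc n) {R = R} I (R⩔R χ η₁ η₂ x D) with ↭-∷-inv x
... | inj₁ (refl , _)  = ⊥-elim (rightInversion-unsplittable I (plug-split χ))
... | inj₂ (_ , q , d) =
  R⩔R χ η₁ η₂ (under-++ ⌜ R ⌝* d) (⊢-resp-↭ʳ (shift _ ⌜ R ⌝* _) (invertʳ n I (⊢-resp-↭ʳ (under q) D)))

LeftContraction : ℕ → Fm → Set
LeftContraction n ν = ∀ {Γ Δ} → ⊢[ n ] ν ∷ ν ∷ Γ ⇒ Δ → ⊢[ n ] ν ∷ Γ ⇒ Δ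

RightContraction : ℕ → CFm → Set
RightContraction n α = ∀ {Γ Δ} → ⊢[ n ] Γ ⇒ ⌜ α ⌝ ∷ ⌜ α ⌝ ∷ Δ → ⊢[ n ] Γ ⇒ ⌜ α ⌝ ∷ Δ

record ContractionBelow (k : ℕ) : Set where
  field
    left  : ∀ {n ν} → size ν < k → LeftContraction n ν
    right : ∀ {n α} → csize α < k → RightContraction n α
open ContractionBelow

ContractionBelow-≤ : ∀ {m k} → m ≤ k → ContractionBelow k → ContractionBelow m
ContractionBelow-≤ m≤k c = record
  { left  = λ ν<m → left c (<-≤-trans ν<m m≤k)
  ; right = λ α<m → right c (<-≤-trans α<m m≤k) }

contractˡ-pair : LeftContraction n φ → LeftContraction n ψ →
                 ⊢[ n ] φ ∷ ψ ∷ φ ∷ ψ ∷ Γ ⇒ Δ → ⊢[ n ] φ ∷ ψ ∷ Γ ⇒ Δ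
contractˡ-pair cφ cψ D =
  ⊢-resp-↭ˡ swap-heads (cψ (⊢-resp-↭ˡ sink₂ (cφ (⊢-resp-↭ˡ (prep _ swap-heads) D))))

contractʳ-pair : ∀ {α β} → RightContraction n α → RightContraction n β →
                 ⊢[ n ] Γ ⇒ ⌜ α ⌝ ∷ ⌜ β ⌝ ∷ ⌜ α ⌝ ∷ ⌜ β ⌝ ∷ Δ → ⊢[ n ] Γ ⇒ ⌜ α ⌝ ∷ ⌜ β ⌝ ∷ Δ
contractʳ-pair cα cβ D =
  ⊢-resp-↭ʳ swap-heads (cβ (⊢-resp-↭ʳ sink₂ (cα (⊢-resp-↭ʳ (prep _ swap-heads) D))))

contractˡ-L∧ : ContractionBelow (size (φ ∧ ψ)) → Γ₀ ↭ (φ ∧ ψ) ∷ Γ →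
               ⊢[ n ] φ ∷ ψ ∷ Γ₀ ⇒ Δ → ⊢[ suc n ] (φ ∧ ψ) ∷ Γ ⇒ Δ
contractˡ-L∧ {φ} {ψ} ih q D =
  L∧ φ ψ refl (contractˡ-pair (left ih (s≤s (m≤m+n _ _))) (left ih (s≤s (m≤n+m _ _)))
                              (invertˡ _ (inv-∧ φ ψ) (⊢-resp-↭ˡ (under₂ q) D)))

contractˡ-L∨ : ContractionBelow (size (φ ∨ ψ)) → Γ₀ ↭ (φ ∨ ψ) ∷ Γ → Δ ↭ ⌜ Λ ⌝* ++ Δ₀ →
               ⊢[ n ] φ ∷ Γ₀ ⇒ ⌜ Λ ⌝* → ⊢[ n ] ψ ∷ Γ₀ ⇒ ⌜ Λ ⌝* → ⊢[ suc n ] (φ ∨ ψ) ∷ Γ ⇒ Δ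
contractˡ-L∨ {φ} {ψ} ih q y D₁ D₂ =
  L∨ φ ψ _ refl y (left ih (s≤s (m≤m+n _ _)) (invertˡ _ (inv-∨ˡ φ ψ) (⊢-resp-↭ˡ (under q) D₁)))
                  (left ih (s≤s (m≤n+m _ _)) (invertˡ _ (inv-∨ʳ φ ψ) (⊢-resp-↭ˡ (under q) D₂)))

contractˡ-L⩔ : ContractionBelow (size φ) → Split φ φL φR → Γ₀ ↭ φ ∷ Γ →
               ⊢[ n ] φL ∷ Γ₀ ⇒ Δ → ⊢[ n ] φR ∷ Γ₀ ⇒ Δ → ⊢[ suc n ] φ ∷ Γ ⇒ Δ
contractˡ-L⩔ ih s q D₁ D₂ =
  L⩔-split s refl
    (left ih (split-size<ˡ s) (invertˡ _ (inv-⇝ (split⇝ˡ s)) (⊢-resp-↭ˡ (under q) D₁)))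
    (left ih (split-size<ʳ s) (invertˡ _ (inv-⇝ (split⇝ʳ s)) (⊢-resp-↭ˡ (under q) D₂)))

contractˡ : ∀ {ν} → ContractionBelow (size ν) → ∀ n → LeftContraction n ν
contractˡ ih zero ()
contractˡ ih (suc n) (ax p x y) with ↭-∷∷-inv x
... | inj₁ (refl , _)  = ax p refl y
... | inj₂ (_ , _ , g) = ax p (under g) y
contractˡ ih (suc n) (ax⊥ x) with ↭-∷∷-inv x
... | inj₁ (refl , _)  = ax⊥ refl
... | inj₂ (_ , _ , g) = ax⊥ (under g)
contractˡ ih (suc n) (L¬ α x D) with ↭-∷∷-inv x
... | inj₁ (refl , q)  = L¬ α refl (right ih ≤-refl (invertˡ n (inv-¬ α) (⊢-resp-↭ˡ q D)))
... | inj₂ (_ , q , g) = L¬ α (under g) (contractˡ ih n (⊢-resp-↭ˡ q D))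
contractˡ ih (suc n) (R¬ α x D) =
  R¬ α x (⊢-resp-↭ˡ swap-heads (contractˡ ih n (⊢-resp-↭ˡ sink₂ D)))
contractˡ ih (suc n) (L∧ φ ψ x D) with ↭-∷∷-inv x
... | inj₁ (refl , q)  = contractˡ-L∧ ih q D
... | inj₂ (_ , q , g) =
  L∧ φ ψ (under g) (⊢-resp-↭ˡ sink₂ (contractˡ ih n (⊢-resp-↭ˡ (under₂ q ∙ prep _ (under₂ refl)) D)))
contractˡ ih (suc n) (R∧ φ ψ Λ x D₁ D₂) = R∧ φ ψ Λ x (contractˡ ih n D₁) (contractˡ ih n D₂)
contractˡ ih (suc n) (L∨ φ ψ Λ x y D₁ D₂) with ↭-∷∷-inv x
... | inj₁ (refl , q)  = contractˡ-L∨ ih q y D₁ D₂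
... | inj₂ (_ , q , g) =
  L∨ φ ψ Λ (under g) y (⊢-resp-↭ˡ swap-heads (contractˡ ih n (⊢-resp-↭ˡ (prep _ q ∙ sink₂) D₁)))
                       (⊢-resp-↭ˡ swap-heads (contractˡ ih n (⊢-resp-↭ˡ (prep _ q ∙ sink₂) D₂)))
contractˡ ih (suc n) (R∨ φ ψ x D) = R∨ φ ψ x (contractˡ ih n D)
contractˡ ih (suc n) (L⩔ χ η₁ η₂ x D₁ D₂) with ↭-∷∷-inv x
... | inj₁ (refl , q)  = contractˡ-L⩔ ih (plug-split χ) q D₁ D₂
... | inj₂ (_ , q , g) =
  L⩔ χ η₁ η₂ (under g) (⊢-resp-↭ˡ swap-heads (contractˡ ih n (⊢-resp-↭ˡ (prep _ q ∙ sink₂) D₁)))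
                       (⊢-resp-↭ˡ swap-heads (contractˡ ih n (⊢-resp-↭ˡ (prep _ q ∙ sink₂) D₂)))
contractˡ ih (suc n) (R⩔L χ η₁ η₂ x D) = R⩔L χ η₁ η₂ x (contractˡ ih n D)
contractˡ ih (suc n) (R⩔R χ η₁ η₂ x D) = R⩔R χ η₁ η₂ x (contractˡ ih n D)

⌜⌝≢plug-⩔ : ∀ α χ {η₁ η₂} → ⌜ α ⌝ ≢ plug χ (η₁ ⩔ η₂)
⌜⌝≢plug-⩔ α χ e = ⌜⌝-unsplittable α (subst (λ φ → Split φ _ _) (sym e) (plug-split χ))

contractʳ-R¬ : ∀ {β} → ContractionBelow (csize α) → ⌜ α ⌝ ≡ ¬f β → Δ₀ ↭ ⌜ α ⌝ ∷ Δ →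
               ⊢[ n ] ⌜ β ⌝ ∷ Γ ⇒ Δ₀ → ⊢[ suc n ] Γ ⇒ ⌜ α ⌝ ∷ Δ
contractʳ-R¬ {α = c¬ β} ih refl q D =
  R¬ β refl (left ih (s≤s (≤-reflexive (size-⌜⌝ β))) (invertʳ _ (inv-¬ β) (⊢-resp-↭ʳ q D)))
contractʳ-R¬ {α = catom _} ih () q D
contractʳ-R¬ {α = c⊥}      ih () q D
contractʳ-R¬ {α = _ c∧ _}  ih () q D
contractʳ-R¬ {α = _ c∨ _}  ih () q D

contractʳ-R∨ : ContractionBelow (csize α) → ⌜ α ⌝ ≡ φ ∨ ψ → Δ₀ ↭ ⌜ α ⌝ ∷ Δ →
               ⊢[ n ] Γ ⇒ φ ∷ ψ ∷ Δ₀ → ⊢[ suc n ] Γ ⇒ ⌜ α ⌝ ∷ Δ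
contractʳ-R∨ {α = α₁ c∨ α₂} ih refl q D =
  R∨ _ _ refl (contractʳ-pair (right ih (s≤s (m≤m+n _ _))) (right ih (s≤s (m≤n+m _ _)))
                              (invertʳ _ (inv-∨ α₁ α₂) (⊢-resp-↭ʳ (under₂ q) D)))
contractʳ-R∨ {α = catom _} ih () q D
contractʳ-R∨ {α = c⊥}      ih () q D
contractʳ-R∨ {α = c¬ _}    ih () q D
contractʳ-R∨ {α = _ c∧ _}  ih () q D

contractʳ-R∧-principal : ContractionBelow (csize α) → ⌜ α ⌝ ≡ φ ∧ ψ → ⌜ Λ ⌝* ++ Δ₀ ↭ ⌜ α ⌝ ∷ Δ →
                         ⊢[ n ] Γ ⇒ φ ∷ ⌜ Λ ⌝* → ⊢[ n ] Γ ⇒ ψ ∷ ⌜ Λ ⌝* → ⊢[ suc n ] Γ ⇒ ⌜ α ⌝ ∷ Δ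
contractʳ-R∧-principal {α = α₁ c∧ α₂} ih refl q D₁ D₂ with ↭-map-++-inv ⌜_⌝ q
... | inj₁ (Λ₁ , h , k) =
  R∧ _ _ Λ₁ (prep _ k)
    (right ih (s≤s (m≤m+n _ _)) (invertʳ _ (inv-∧ˡ α₁ α₂) (⊢-resp-↭ʳ (prep _ h ∙ swap-heads) D₁)))
    (right ih (s≤s (m≤n+m _ _)) (invertʳ _ (inv-∧ʳ α₁ α₂) (⊢-resp-↭ʳ (prep _ h ∙ swap-heads) D₂)))
... | inj₂ (_ , k) = R∧ _ _ _ (prep _ k) D₁ D₂
contractʳ-R∧-principal {α = catom _} ih () q D₁ D₂
contractʳ-R∧-principal {α = c⊥}      ih () q D₁ D₂
contractʳ-R∧-principal {α = c¬ _}    ih () q D₁ D₂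
contractʳ-R∧-principal {α = _ c∨ _}  ih () q D₁ D₂

contractʳ-R∧ : ContractionBelow (csize α) → RightContraction n α →
               ⌜ α ⌝ ∷ ⌜ α ⌝ ∷ Δ ↭ (φ ∧ ψ) ∷ ⌜ Λ ⌝* ++ Δ₀ →
               ⊢[ n ] Γ ⇒ φ ∷ ⌜ Λ ⌝* → ⊢[ n ] Γ ⇒ ψ ∷ ⌜ Λ ⌝* → ⊢[ suc n ] Γ ⇒ ⌜ α ⌝ ∷ Δ
contractʳ-R∧ {α = α} ih ihₙ x D₁ D₂ with ↭-∷∷-inv x
... | inj₁ (e , q) = contractʳ-R∧-principal ih e q D₁ D₂
... | inj₂ (_ , q , d) with ↭-map-++-inv₂ ⌜_⌝ q
...   | inj₁ (Λ₂ , h , k) =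
  R∧ _ _ (α ∷ Λ₂) (under d ∙ prep _ (prep _ k))
    (⊢-resp-↭ʳ swap-heads (ihₙ (⊢-resp-↭ʳ (prep _ h ∙ sink₂) D₁)))
    (⊢-resp-↭ʳ swap-heads (ihₙ (⊢-resp-↭ʳ (prep _ h ∙ sink₂) D₂)))
...   | inj₂ (_ , k) = R∧ _ _ _ (under d ∙ prep _ k) D₁ D₂

contractʳ : ∀ {α} → ContractionBelow (csize α) → ∀ n → RightContraction n α
contractʳ ih zero ()
contractʳ ih (suc n) (ax p x y) with ↭-∷∷-inv y
... | inj₁ (e , _)     = ax p x (↭-reflexive (cong (_∷ _) e))
... | inj₂ (_ , _ , d) = ax p x (under d)
contractʳ ih (suc n) (ax⊥ x) = ax⊥ x
contractʳ ih (suc n) (L¬ β x D) =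
  L¬ β x (⊢-resp-↭ʳ swap-heads (contractʳ ih n (⊢-resp-↭ʳ sink₂ D)))
contractʳ ih (suc n) (R¬ β x D) with ↭-∷∷-inv x
... | inj₁ (e , q)     = contractʳ-R¬ ih e q D
... | inj₂ (_ , q , d) = R¬ β (under d) (contractʳ ih n (⊢-resp-↭ʳ q D))
contractʳ ih (suc n) (L∧ φ ψ x D) = L∧ φ ψ x (contractʳ ih n D)
contractʳ ih (suc n) (R∧ φ ψ Λ x D₁ D₂) = contractʳ-R∧ ih (contractʳ ih n) x D₁ D₂
contractʳ ih (suc n) (L∨ φ ψ Λ x y D₁ D₂) with ↭-map-++-inv₂ ⌜_⌝ (↭-sym y)
... | inj₁ (Λ₂ , h , k) =
  L∨ φ ψ (_ ∷ Λ₂) x (prep _ k) (contractʳ ih n (⊢-resp-↭ʳ h D₁)) (contractʳ ih n (⊢-resp-↭ʳ h D₂))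
... | inj₂ (_ , k) = L∨ φ ψ Λ x k D₁ D₂
contractʳ ih (suc n) (R∨ φ ψ x D) with ↭-∷∷-inv x
... | inj₁ (e , q)     = contractʳ-R∨ ih e q D
... | inj₂ (_ , q , d) =
  R∨ φ ψ (under d) (⊢-resp-↭ʳ sink₂ (contractʳ ih n (⊢-resp-↭ʳ (under₂ q ∙ prep _ (under₂ refl)) D)))
contractʳ ih (suc n) (L⩔ χ η₁ η₂ x D₁ D₂) = L⩔ χ η₁ η₂ x (contractʳ ih n D₁) (contractʳ ih n D₂)
contractʳ {α} ih (suc n) (R⩔L χ η₁ η₂ x D) with ↭-∷∷-inv x
... | inj₁ (e , _)     = ⊥-elim (⌜⌝≢plug-⩔ α χ e)
... | inj₂ (_ , q , d) =
  R⩔L χ η₁ η₂ (under d) (⊢-resp-↭ʳ swap-heads (contractʳ ih n (⊢-resp-↭ʳ (prep _ q ∙ sink₂) D)))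
contractʳ {α} ih (suc n) (R⩔R χ η₁ η₂ x D) with ↭-∷∷-inv x
... | inj₁ (e , _)     = ⊥-elim (⌜⌝≢plug-⩔ α χ e)
... | inj₂ (_ , q , d) =
  R⩔R χ η₁ η₂ (under d) (⊢-resp-↭ʳ swap-heads (contractʳ ih n (⊢-resp-↭ʳ (prep _ q ∙ sink₂) D)))

contraction : ∀ k → ContractionBelow k
contraction zero    = record { left = λ () ; right = λ () }
contraction (suc k) = record
  { left  = λ ν<1+k → contractˡ (ContractionBelow-≤ (≤-pred ν<1+k) (contraction k)) _
  ; right = λ α<1+k → contractʳ (ContractionBelow-≤ (≤-pred α<1+k) (contraction k)) _ }

mainTheorem4 : (∀ (n : ℕ) (Γ Δ : List Fm) (ν : Fm) → ⊢[ n ] ν ∷ ν ∷ Γ ⇒ Δ → ⊢[ n ] ν ∷ Γ ⇒ Δ)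
    × (∀ (n : ℕ) (Γ Δ : List Fm) (α : CFm) → ⊢[ n ] Γ ⇒ ⌜ α ⌝ ∷ ⌜ α ⌝ ∷ Δ → ⊢[ n ] Γ ⇒ ⌜ α ⌝ ∷ Δ)
mainTheorem4 = (λ n Γ Δ ν → contractˡ (contraction (size ν)) n)
             , (λ n Γ Δ α → contractʳ (contraction (csize α)) n)
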